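{- Let $evs\in\mathit{nsl}$, let $A,B$ be agents with $A\notin\mathit{bad}$ and $B\notin\mathit{bad}$, and suppose $\mathit{Says}\ B\ A\ (\mathit{Crypt}\ (\mathit{pubK}\ A)\ \langle\mathit{Nonce}\ NA,\mathit{Nonce}\ NB,\mathit{Agent}\ B\rangle)\in\mathit{set}\ evs$. Then every message of $\mathit{spies}\ evs$ belongs to $\mathit{guard}\ NB\ \{\mathit{priK}\ A,\mathit{priK}\ B\}$.
   Context: Messages: free datatype msg ::= Number nat | Nonce nat | Agent agent | Key key | Hash msg | ⟨msg,msg⟩ | Crypt key msg; ⟨X,Y,Z⟩ abbreviates ⟨X,⟨Y,Z⟩⟩. Each agent $A$ has a public key $\mathit{pubK}\ A$ and private key $\mathit{priK}\ A$, inverse to each other under $\mathit{invKey}$. $\mathit{parts}\ H$ closes $H$ under pair components and encryption bodies; $\mathit{analz}\ H$ closes $H$ under pair components and decryption of $\mathit{Crypt}\ K\ X$ when $\mathit{Key}(\mathit{invKey}\ K)$ is already in it; $\mathit{synth}\ H$ closes $H$ under adding agent names, numbers, hashing, pairing and encryption with keys $\mathit{Key}\ K\in H$. $\mathit{bad}$ is the set of compromised agents. Events are $\mathit{Says}\ A\ B\ X$; $\mathit{set}\ evs$ is the set of events of trace $evs$; $\mathit{spies}\ evs$ is the spy's knowledge: its initial knowledge (all public keys, private keys of bad agents) plus every message sent in $evs$; $\mathit{used}\ evs$ is the parts of all messages sent (and of initial knowledge). $\mathit{nsl}$ is the least set of traces with: $[]\in\mathit{nsl}$; (Fake) $evs\in\mathit{nsl}$,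 $X\in\mathit{synth}(\mathit{analz}(\mathit{spies}\ evs))\Rightarrow \mathit{Says}\ \mathit{Spy}\ B\ X\#evs\in\mathit{nsl}$; (NS1) $evs\in\mathit{nsl}$, $\mathit{Nonce}\ NA\notin\mathit{used}\ evs\Rightarrow \mathit{Says}\ A\ B\ (\mathit{Crypt}(\mathit{pubK}\ B)\langle\mathit{Nonce}\ NA,\mathit{Agent}\ A\rangle)\#evs\in\mathit{nsl}$; (NS2) $evs\in\mathit{nsl}$, $\mathit{Nonce}\ NB\notin\mathit{used}\ evs$, $\mathit{Says}\ A'\ B\ (\mathit{Crypt}(\mathit{pubK}\ B)\langle\mathit{Nonce}\ NA,\mathit{Agent}\ A\rangle)\in\mathit{set}\ evs\Rightarrow \mathit{Says}\ B\ A\ (\mathit{Crypt}(\mathit{pubK}\ A)\langle\mathit{Nonce}\ NA,\mathit{Nonce}\ NB,\mathit{Agent}\ B\rangle)\#evs\in\mathit{nsl}$; (NS3) $evs\in\mathit{nsl}$, $\mathit{Says}\ A\ B\ (\mathit{Crypt}(\mathit{pubK}\ B)\langle\mathit{Nonce}\ NA,\mathit{Agent}\ A\rangle)\in\mathit{set}\ evs$, $\mathit{Says}\ B'\ A\ (\mathit{Crypt}(\mathit{pubK}\ A)\langle\mathit{Nonce}\ NA,\mathit{Nonce}\ NB,\mathit{Agent}\ B\rangle)\in\mathit{set}\ evs\Rightarrow\mathit{Says}\ A\ B\ (\mathit{Crypt}(\mathit{pubK}\ B)(\mathit{Nonce}\ NB))\#evs\in\mathit{nsl}$. $\mathit{guard}\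 n\ Ks$ is the least set of messages containing: every $X$ with $\mathit{Nonce}\ n\notin\mathit{parts}\{X\}$; every $\mathit{Crypt}\ K\ X$ with $\mathit{invKey}\ K\in Ks$; $\mathit{Crypt}\ K\ X$ whenever $X\in\mathit{guard}\ n\ Ks$; $\langle X,Y\rangle$ whenever $X,Y\in\mathit{guard}\ n\ Ks$. -}

module Defs where

open import Data.Nat using (ℕ)

open import Data.Sum using (_⊎_)
open import Data.List using (List; []; _∷_)
open import Data.List.Membership.Propositional using (_∈_)
open import Relation.Binary.PropositionalEquality using (_≡_)
open import Relation.Nullary using (¬_)

data Agent : Set where
  Server : Agent
  Friend : ℕ → Agent
  Spy    : Agent

data Key : Set where
  pubK : Agent → Key
  priK : Agent → Key

invKey : Key → Key
invKey (pubK A) = priK A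
invKey (priK A) = pubK A

data Msg : Set where
  Number : ℕ → Msg
  Nonce  : ℕ → Msg
  AgentM : Agent → Msg      -- the constructor 'Agent' of msg
  KeyM   : Key → Msg        -- the constructor 'Key' of msg
  Hash   : Msg → Msg
  ⟨_,_⟩  : Msg → Msg → Msg
  Crypt  : Key → Msg → Msg

⟪_,_,_⟫ : Msg → Msg → Msg → Msg
⟪ X , Y , Z ⟫ = ⟨ X , ⟨ Y , Z ⟩ ⟩

MsgSet : Set₁
MsgSet = Msg → Set

data parts (H : MsgSet) : MsgSet where
  inj  : ∀ {X} → H X → parts H X
  fst  : ∀ {X Y} → parts H ⟨ X , Y ⟩ → parts H X
  snd  : ∀ {X Y} → parts H ⟨ X , Y ⟩ → parts H Y
  body : ∀ {K X} → parts H (Crypt K X) → parts H X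

data analz (H : MsgSet) : MsgSet where
  inj    : ∀ {X} → H X → analz H X
  fst    : ∀ {X Y} → analz H ⟨ X , Y ⟩ → analz H X
  snd    : ∀ {X Y} → analz H ⟨ X , Y ⟩ → analz H Y
  decrypt : ∀ {K X} → analz H (Crypt K X) → analz H (KeyM (invKey K)) → analz H X

data synth (H : MsgSet) : MsgSet where
  inj    : ∀ {X} → H X → synth H X
  agent  : ∀ A → synth H (AgentM A)
  number : ∀ n → synth H (Number n)
  hash   : ∀ {X} → synth H X → synth H (Hash X)
  pair   : ∀ {X Y} → synth H X → synth H Y → synth H ⟨ X , Y ⟩
  crypt  : ∀ {K X} → synth H X → H (KeyM K) → synth H (Crypt K X)

｛_｝ : Msg → MsgSet
｛ X ｝ Y = Y ≡ X

data Event : Set where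
  Says : Agent → Agent → Msg → Event

data initSpy (bad : Agent → Set) : MsgSet where
  pubKey : ∀ A → initSpy bad (KeyM (pubK A))
  badKey : ∀ {A} → bad A → initSpy bad (KeyM (priK A))

data spies (bad : Agent → Set) (evs : List Event) : MsgSet where
  init : ∀ {X} → initSpy bad X → spies bad evs X
  said : ∀ {A B X} → Says A B X ∈ evs → spies bad evs X

data initState : MsgSet where
  pubKey : ∀ A → initState (KeyM (pubK A))
  priKey : ∀ A → initState (KeyM (priK A))

data sentOrInit (evs : List Event) : MsgSet where
  init : ∀ {X} → initState X → sentOrInit evs X
  said : ∀ {A B X} → Says A B X ∈ evs → sentOrInit evs X

used : List Event → MsgSet
used evs = parts (sentOrInit evs)

data nsl (bad : Agent → Set) : List Event → Set where
  Nil  : nsl bad []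
  Fake : ∀ {evs B X} → nsl bad evs → synth (analz (spies bad evs)) X →
         nsl bad (Says Spy B X ∷ evs)
  NS1  : ∀ {evs A B NA} → nsl bad evs → ¬ used evs (Nonce NA) →
         nsl bad (Says A B (Crypt (pubK B) ⟨ Nonce NA , AgentM A ⟩) ∷ evs)
  NS2  : ∀ {evs A A' B NA NB} → nsl bad evs → ¬ used evs (Nonce NB) →
         Says A' B (Crypt (pubK B) ⟨ Nonce NA , AgentM A ⟩) ∈ evs →
         nsl bad (Says B A (Crypt (pubK A) ⟪ Nonce NA , Nonce NB , AgentM B ⟫) ∷ evs)
  NS3  : ∀ {evs A B B' NA NB} → nsl bad evs →
         Says A B (Crypt (pubK B) ⟨ Nonce NA , AgentM A ⟩) ∈ evs →
         Says B' A (Crypt (pubK A) ⟪ Nonce NA , Nonce NB , AgentM B ⟫) ∈ evs →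
         nsl bad (Says A B (Crypt (pubK B) (Nonce NB)) ∷ evs)

data guard (n : ℕ) (Ks : Key → Set) : MsgSet where
  noNonce : ∀ {X} → ¬ parts ｛ X ｝ (Nonce n) → guard n Ks X
  keyed   : ∀ {K X} → Ks (invKey K) → guard n Ks (Crypt K X)
  crypt   : ∀ {K X} → guard n Ks X → guard n Ks (Crypt K X)
  pair    : ∀ {X Y} → guard n Ks X → guard n Ks Y → guard n Ks ⟨ X , Y ⟩

keyPair : Agent → Agent → Key → Set
keyPair A B K = (K ≡ priK A) ⊎ (K ≡ priK B)

-- Strengthen the claim to an invariant on every message X the spy sees: X is
-- guarded, no ciphertext inside X has the shape ⟨NB, E⟩ of a first message, and
-- every ciphertext inside X of the shape ⟨x, NB, E⟩ of a second message names
-- E = B.  The last two clauses are exactly what the honest steps need: an NS2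
-- step re-sends the nonce of a first message in a reply to E, and an NS3 step
-- returns the second nonce of a second message to the agent it names.  The spy
-- keeps the invariant because the private keys of honest agents are never sent,
-- so analysis preserves guardedness, and the body of a ciphertext of either
-- shape exposes NB in clear, so the spy can only replay such ciphertexts.
module Submission where

open import Defs
open import Data.Nat using (ℕ; _≟_)
open import Data.List using (List; _∷_)
open import Data.List.Membership.Propositional using (_∈_)
open import Data.List.Relation.Unary.Any using (here; there)
open import Data.Product using (∃-syntax; _×_; _,_; map₂)
open import Data.Sum using (_⊎_; inj₁; inj₂)
open import Data.Empty using (⊥-elim)
open import Function using (_∘_)
open import Relation.Nullary using (¬_; yes; no)
open import Relation.Unary using (_⊆_)
open import Relation.Binary.PropositionalEquality using (_≡_; _≢_; refl; cong)

infix 4 _⊑_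

data _⊑_ (Z : Msg) : Msg → Set where
  ⊑-refl : Z ⊑ Z
  ⊑-fst  : ∀ {X Y} → Z ⊑ X → Z ⊑ ⟨ X , Y ⟩
  ⊑-snd  : ∀ {X Y} → Z ⊑ Y → Z ⊑ ⟨ X , Y ⟩
  ⊑-body : ∀ {K X} → Z ⊑ X → Z ⊑ Crypt K X

⊑-trans : ∀ {Z Y X} → Z ⊑ Y → Y ⊑ X → Z ⊑ X
⊑-trans s ⊑-refl     = s
⊑-trans s (⊑-fst t)  = ⊑-fst (⊑-trans s t)
⊑-trans s (⊑-snd t)  = ⊑-snd (⊑-trans s t)
⊑-trans s (⊑-body t) = ⊑-body (⊑-trans s t)

⊑⇒parts : ∀ {H Z X} → Z ⊑ X → parts H X → parts H Z
⊑⇒parts ⊑-refl     p = p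
⊑⇒parts (⊑-fst s)  p = ⊑⇒parts s (fst p)
⊑⇒parts (⊑-snd s)  p = ⊑⇒parts s (snd p)
⊑⇒parts (⊑-body s) p = ⊑⇒parts s (body p)

parts⇒⊑ : ∀ {H Z} → parts H Z → ∃[ X ] H X × Z ⊑ X
parts⇒⊑ (inj h)  = _ , h , ⊑-refl
parts⇒⊑ (fst p)  = map₂ (map₂ (⊑-trans (⊑-fst ⊑-refl))) (parts⇒⊑ p)
parts⇒⊑ (snd p)  = map₂ (map₂ (⊑-trans (⊑-snd ⊑-refl))) (parts⇒⊑ p)
parts⇒⊑ (body p) = map₂ (map₂ (⊑-trans (⊑-body ⊑-refl))) (parts⇒⊑ p)

⊑⇒parts｛｝ : ∀ {Z X} → Z ⊑ X → parts ｛ X ｝ Z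
⊑⇒parts｛｝ s = ⊑⇒parts s (inj refl)

parts｛｝⇒⊑ : ∀ {Z X} → parts ｛ X ｝ Z → Z ⊑ X
parts｛｝⇒⊑ p with parts⇒⊑ p
... | _ , refl , s = s

⋢⇒¬parts : ∀ {H Z} → H ⊆ (λ X → ¬ Z ⊑ X) → ¬ parts H Z
⋢⇒¬parts H⋢ p with parts⇒⊑ p
... | _ , h , s = H⋢ h s

analz⊆parts : ∀ {H} → analz H ⊆ parts H
analz⊆parts (inj h)       = inj h
analz⊆parts (fst a)       = fst (analz⊆parts a)
analz⊆parts (snd a)       = snd (analz⊆parts a)
analz⊆parts (decrypt a _) = body (analz⊆parts a)

⊑-synth-analz : ∀ {H Z X} → synth (analz H) X → Z ⊑ X → synth (analz H) Z ⊎ parts H Z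
⊑-synth-analz (inj a)     s          = inj₂ (⊑⇒parts s (analz⊆parts a))
⊑-synth-analz x           ⊑-refl     = inj₁ x
⊑-synth-analz (pair x _)  (⊑-fst s)  = ⊑-synth-analz x s
⊑-synth-analz (pair _ y)  (⊑-snd s)  = ⊑-synth-analz y s
⊑-synth-analz (crypt x _) (⊑-body s) = ⊑-synth-analz x s

synth-analz-⋢key : ∀ {H k} → H ⊆ (λ X → ¬ KeyM k ⊑ X) →
  synth (analz H) ⊆ (λ X → ¬ KeyM k ⊑ X)
synth-analz-⋢key H⋢ x s with ⊑-synth-analz x s
... | inj₁ (inj a) = ⋢⇒¬parts H⋢ (analz⊆parts a)
... | inj₂ p       = ⋢⇒¬parts H⋢ p

guard-⋢ : ∀ {n Ks X} → ¬ Nonce n ⊑ X → guard n Ks X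
guard-⋢ n⋢X = noNonce (λ p → n⋢X (parts｛｝⇒⊑ p))

¬guard-nonce : ∀ {n Ks} → ¬ guard n Ks (Nonce n)
¬guard-nonce (noNonce n∉) = n∉ (inj refl)

guard-fst : ∀ {n Ks X Y} → guard n Ks ⟨ X , Y ⟩ → guard n Ks X
guard-fst (noNonce n∉) = guard-⋢ (λ s → n∉ (⊑⇒parts｛｝ (⊑-fst s)))
guard-fst (pair g _)   = g

guard-snd : ∀ {n Ks X Y} → guard n Ks ⟨ X , Y ⟩ → guard n Ks Y
guard-snd (noNonce n∉) = guard-⋢ (λ s → n∉ (⊑⇒parts｛｝ (⊑-snd s)))
guard-snd (pair _ g)   = g

guard-body : ∀ {n Ks K X} → guard n Ks (Crypt K X) → Ks (invKey K) ⊎ guard n Ks X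
guard-body (noNonce n∉) = inj₂ (guard-⋢ (λ s → n∉ (⊑⇒parts｛｝ (⊑-body s))))
guard-body (keyed k)    = inj₁ k
guard-body (crypt g)    = inj₂ g

analz-guard : ∀ {H n Ks} → H ⊆ guard n Ks → (∀ {K} → Ks K → ¬ analz H (KeyM K)) →
  analz H ⊆ guard n Ks
analz-guard G secret (inj h) = G h
analz-guard G secret (fst a) = guard-fst (analz-guard G secret a)
analz-guard G secret (snd a) = guard-snd (analz-guard G secret a)
analz-guard G secret (decrypt a k) with guard-body (analz-guard G secret a)
... | inj₁ Ks-k = ⊥-elim (secret Ks-k k)
... | inj₂ g    = g

synth-guard : ∀ {H n Ks} → H ⊆ guard n Ks → synth H ⊆ guard n Ks
synth-guard G (inj h)     = G h
synth-guard G (agent _)   = guard-⋢ (λ ())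
synth-guard G (number _)  = guard-⋢ (λ ())
synth-guard G (hash _)    = guard-⋢ (λ ())
synth-guard G (pair x y)  = pair (synth-guard G x) (synth-guard G y)
synth-guard G (crypt x _) = crypt (synth-guard G x)

synth-crypt-unguarded⇒parts : ∀ {H n Ks K Y X} → synth (analz H) ⊆ guard n Ks →
  ¬ guard n Ks Y → synth (analz H) X → Crypt K Y ⊑ X → parts H (Crypt K Y)
synth-crypt-unguarded⇒parts G ¬gY x s with ⊑-synth-analz x s
... | inj₂ p            = p
... | inj₁ (inj a)      = analz⊆parts a
... | inj₁ (crypt y _)  = ⊥-elim (¬gY (G y))

spies-∷-⊆ : ∀ {bad evs C D Y} {P : MsgSet} → P Y → spies bad evs ⊆ P →
  spies bad (Says C D Y ∷ evs) ⊆ P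
spies-∷-⊆ pY I (init i)             = I (init i)
spies-∷-⊆ pY I (said (here refl))   = pY
spies-∷-⊆ pY I (said (there Y∈evs)) = I (said Y∈evs)

sent-⊑-used : ∀ {evs C D X Z} → Says C D X ∈ evs → Z ⊑ X → used evs Z
sent-⊑-used X∈evs s = ⊑⇒parts s (inj (said X∈evs))

spies-⊑-used : ∀ {bad evs X Z} → spies bad evs X → Z ⊑ X → used evs Z
spies-⊑-used (init (pubKey A))     s = ⊑⇒parts s (inj (init (pubKey A)))
spies-⊑-used (init (badKey {A} _)) s = ⊑⇒parts s (inj (init (priKey A)))
spies-⊑-used (said X∈evs)          s = sent-⊑-used X∈evs s

unused≢used : ∀ {evs n m} → ¬ used evs (Nonce n) → used evs (Nonce m) → m ≢ n
unused≢used n-unused m-used refl = n-unused m-used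

priK-unsent : ∀ {bad evs C} → nsl bad evs → ¬ bad C →
  spies bad evs ⊆ (λ X → ¬ KeyM (priK C) ⊑ X)
priK-unsent Nil ¬bC (init (pubKey _)) ()
priK-unsent Nil ¬bC (init (badKey bC)) ⊑-refl = ¬bC bC
priK-unsent Nil ¬bC (said ())
priK-unsent (Fake evs∈ X∈) ¬bC =
  spies-∷-⊆ (synth-analz-⋢key (priK-unsent evs∈ ¬bC) X∈) (priK-unsent evs∈ ¬bC)
priK-unsent (NS1 evs∈ _) ¬bC =
  spies-∷-⊆ (λ { (⊑-body (⊑-fst ())) ; (⊑-body (⊑-snd ())) }) (priK-unsent evs∈ ¬bC)
priK-unsent (NS2 evs∈ _ _) ¬bC =
  spies-∷-⊆ (λ { (⊑-body (⊑-fst ())) ; (⊑-body (⊑-snd (⊑-fst ())))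
                ; (⊑-body (⊑-snd (⊑-snd ()))) })
            (priK-unsent evs∈ ¬bC)
priK-unsent (NS3 evs∈ _ _) ¬bC = spies-∷-⊆ (λ { (⊑-body ()) }) (priK-unsent evs∈ ¬bC)

keyPair-secret : ∀ {bad evs A B K} → nsl bad evs → ¬ bad A → ¬ bad B →
  keyPair A B K → ¬ analz (spies bad evs) (KeyM K)
keyPair-secret evs∈ ¬bA ¬bB (inj₁ refl) = ⋢⇒¬parts (priK-unsent evs∈ ¬bA) ∘ analz⊆parts
keyPair-secret evs∈ ¬bA ¬bB (inj₂ refl) = ⋢⇒¬parts (priK-unsent evs∈ ¬bB) ∘ analz⊆parts

nonce⊑ns1 : ∀ {n m K a} → Nonce n ⊑ Crypt K ⟨ Nonce m , AgentM a ⟩ → n ≡ m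
nonce⊑ns1 (⊑-body (⊑-fst ⊑-refl)) = refl
nonce⊑ns1 (⊑-body (⊑-snd ()))

nonce⊑ns2 : ∀ {n K a b c} → Nonce n ⊑ Crypt K ⟪ Nonce a , Nonce b , AgentM c ⟫ → n ≡ a ⊎ n ≡ b
nonce⊑ns2 (⊑-body (⊑-fst ⊑-refl))         = inj₁ refl
nonce⊑ns2 (⊑-body (⊑-snd (⊑-fst ⊑-refl))) = inj₂ refl
nonce⊑ns2 (⊑-body (⊑-snd (⊑-snd ())))

nonce⊑ns3 : ∀ {n K b} → Nonce n ⊑ Crypt K (Nonce b) → n ≡ b
nonce⊑ns3 (⊑-body ⊑-refl) = refl

ns2-nonce⊑ : ∀ {K a b W} → Nonce b ⊑ Crypt K ⟪ Nonce a , Nonce b , W ⟫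
ns2-nonce⊑ = ⊑-body (⊑-snd (⊑-fst ⊑-refl))

record Safe (A B : Agent) (NB : ℕ) (X : Msg) : Set where
  field
    guarded     : guard NB (keyPair A B) X
    never-ns1   : ∀ {K E} → ¬ Crypt K ⟨ Nonce NB , AgentM E ⟩ ⊑ X
    ns2-names-B : ∀ {K x E} → Crypt K ⟪ Nonce x , Nonce NB , AgentM E ⟫ ⊑ X → E ≡ B

Safe-⋢ : ∀ {A B NB X} → ¬ Nonce NB ⊑ X → Safe A B NB X
Safe-⋢ NB⋢X = record
  { guarded     = guard-⋢ NB⋢X
  ; never-ns1   = λ s → NB⋢X (⊑-trans (⊑-body (⊑-fst ⊑-refl)) s)
  ; ns2-names-B = λ s → ⊥-elim (NB⋢X (⊑-trans ns2-nonce⊑ s))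
  }

Safe-ns2 : ∀ {A B NA NB} → Safe A B NB (Crypt (pubK A) ⟪ Nonce NA , Nonce NB , AgentM B ⟫)
Safe-ns2 = record
  { guarded     = keyed (inj₁ refl)
  ; never-ns1   = λ { (⊑-body (⊑-fst ())) ; (⊑-body (⊑-snd (⊑-fst ())))
                    ; (⊑-body (⊑-snd (⊑-snd ()))) }
  ; ns2-names-B = λ { ⊑-refl → refl ; (⊑-body (⊑-fst ())) ; (⊑-body (⊑-snd (⊑-fst ())))
                    ; (⊑-body (⊑-snd (⊑-snd ()))) }
  }

Safe-crypt-nonce : ∀ {A B NB K n} → guard NB (keyPair A B) (Crypt K (Nonce n)) →
  Safe A B NB (Crypt K (Nonce n))
Safe-crypt-nonce g = record
  { guarded = g ; never-ns1 = λ { (⊑-body ()) } ; ns2-names-B = λ { (⊑-body ()) } }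

Safe-synth-analz : ∀ {H A B NB} → H ⊆ Safe A B NB →
  (∀ {K} → keyPair A B K → ¬ analz H (KeyM K)) → synth (analz H) ⊆ Safe A B NB
Safe-synth-analz {H} {A} {B} {NB} safe secret {X} x = record
  { guarded     = G x
  ; never-ns1   = λ s → let _ , h , t = replayed (¬guard-nonce ∘ guard-fst) s
                        in Safe.never-ns1 (safe h) t
  ; ns2-names-B = λ s → let _ , h , t = replayed (¬guard-nonce ∘ guard-fst ∘ guard-snd) s
                        in Safe.ns2-names-B (safe h) t
  }
  where
  G : synth (analz H) ⊆ guard NB (keyPair A B)
  G = synth-guard (analz-guard (λ h → Safe.guarded (safe h)) secret)
  replayed : ∀ {K Y} → ¬ guard NB (keyPair A B) Y → Crypt K Y ⊑ X → ∃[ W ] H W × Crypt K Y ⊑ W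
  replayed ¬gY s = parts⇒⊑ (synth-crypt-unguarded⇒parts G ¬gY x s)

Safe-spies : ∀ {bad evs A B NA NB} → bad Spy → nsl bad evs → ¬ bad A → ¬ bad B →
  Says B A (Crypt (pubK A) ⟪ Nonce NA , Nonce NB , AgentM B ⟫) ∈ evs →
  spies bad evs ⊆ Safe A B NB
Safe-spies badSpy Nil ¬bA ¬bB ()
Safe-spies badSpy (Fake _ _) ¬bA ¬bB (here refl) = ⊥-elim (¬bB badSpy)
Safe-spies badSpy (Fake evs∈ X∈) ¬bA ¬bB (there ns2∈) =
  spies-∷-⊆ (Safe-synth-analz I (keyPair-secret evs∈ ¬bA ¬bB) X∈) I
  where I = Safe-spies badSpy evs∈ ¬bA ¬bB ns2∈
Safe-spies badSpy (NS1 _ _) ¬bA ¬bB (here ())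
Safe-spies badSpy (NS1 evs∈ NA-fresh) ¬bA ¬bB (there ns2∈) =
  spies-∷-⊆ (Safe-⋢ (unused≢used NA-fresh (sent-⊑-used ns2∈ ns2-nonce⊑) ∘ nonce⊑ns1))
            (Safe-spies badSpy evs∈ ¬bA ¬bB ns2∈)
Safe-spies badSpy (NS2 evs∈ NB-fresh _) ¬bA ¬bB (here refl) =
  spies-∷-⊆ Safe-ns2 (λ X∈ → Safe-⋢ (λ s → NB-fresh (spies-⊑-used X∈ s)))
Safe-spies {NB = NB} badSpy (NS2 {A = A′} {B = B′} {NA′} {NB′} evs∈ NB′-fresh ns1∈) ¬bA ¬bB
           (there ns2∈) =
  spies-∷-⊆ (Safe-⋢ NB⋢) I
  where
  I = Safe-spies badSpy evs∈ ¬bA ¬bB ns2∈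
  NB⋢ : ¬ Nonce NB ⊑ Crypt (pubK A′) ⟪ Nonce NA′ , Nonce NB′ , AgentM B′ ⟫
  NB⋢ s with nonce⊑ns2 s
  ... | inj₁ refl   = Safe.never-ns1 (I (said ns1∈)) ⊑-refl
  ... | inj₂ NB≡NB′ = unused≢used NB′-fresh (sent-⊑-used ns2∈ ns2-nonce⊑) NB≡NB′
Safe-spies badSpy (NS3 _ _ _) ¬bA ¬bB (here ())
Safe-spies {A = A} {B} {NB = NB} badSpy (NS3 {B = B′} {NB = NB′} evs∈ _ ns2′∈) ¬bA ¬bB
           (there ns2∈) =
  spies-∷-⊆ ns3-safe I
  where
  I = Safe-spies badSpy evs∈ ¬bA ¬bB ns2∈
  ns3-safe : Safe A B NB (Crypt (pubK B′) (Nonce NB′))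
  ns3-safe with NB ≟ NB′
  ... | no NB≢NB′ = Safe-⋢ (NB≢NB′ ∘ nonce⊑ns3)
  ... | yes refl  =
    Safe-crypt-nonce (keyed (inj₂ (cong priK (Safe.ns2-names-B (I (said ns2′∈)) ⊑-refl))))

mainTheorem5 : (bad : Agent → Set) → bad Spy →
    ∀ {evs : List Event} {A B : Agent} {NA NB : ℕ} →
    nsl bad evs → ¬ bad A → ¬ bad B →
    Says B A (Crypt (pubK A) ⟪ Nonce NA , Nonce NB , AgentM B ⟫) ∈ evs →
    ∀ {X} → spies bad evs X → guard NB (keyPair A B) X
mainTheorem5 _ badSpy evs∈ ¬bA ¬bB ns2∈ X∈ =
  Safe.guarded (Safe-spies badSpy evs∈ ¬bA ¬bB ns2∈ X∈)
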